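{- Let $N$ be a positive integer, write $\mathbb{T}=t_0t_1t_2\ldots$, and set $x=t_Nt_{N-1}\ldots t_0\mathbb{T}\in\{0,1\}^\omega$ (the finite word $t_Nt_{N-1}\cdots t_0$ followed by $\mathbb{T}$); this $x$ lies in the shift orbit closure $\Omega(\mathbb{T})$. Consider the partition $\mathbb{N}=A_0\cup A_1$ where $A_0=x|_0$ and $A_1=x|_1$. Then $A_i-n$ is an IP-set for each $i\in\{0,1\}$ and each $0\leq n\leq N$. On the other hand, for each $n>N$, exactly one of the sets $A_0-n$, $A_1-n$ is an IP-set.
   Context: $\mathbb{N}$ denotes the set of positive integers. The Thue-Morse word is $\mathbb{T}=t_0t_1t_2\ldots\in\{0,1\}^\omega$, where $t_n$ is the sum modulo $2$ of the binary digits of $n$. $T$ is the shift on $\{0,1\}^\omega$ and $\Omega(\mathbb{T})$ is the closure (in the product topology) of $\{T^n(\mathbb{T}):n\ge 0\}$. For $x=x_0x_1x_2\ldots\in\{0,1\}^\omega$ and $a\in\{0,1\}$, $x|_a=\{m\in\mathbb{N}: x_m=a\}$. For $A\subseteq\mathbb{N}$ and $n\ge 0$, $A-n=\{m\in\mathbb{N}: m+n\in A\}$. A set $A\subseteq\mathbb{N}$ is an IP-set if there is an infinite sequence $\langle y_t\rangle_{t=1}^\infty$ in $\mathbb{N}$ with $\sum_{t\in F}y_t\in A$ for every finite nonempty $F\subseteq\mathbb{N}$. -}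

module Defs where

open import Data.Nat using (ℕ; zero; suc; _+_; _∸_; _≤_; _<_; _≤?_)
open import Data.Nat.DivMod using (_/_; _%_)
open import Data.Bool using (if_then_else_)
open import Data.List using (List; []; _∷_; map)
open import Data.Nat.ListAction using (sum)
open import Data.List.Relation.Unary.Unique.Propositional using (Unique)
open import Data.Product using (Σ; _×_)
open import Data.Sum using (_⊎_)
open import Relation.Nullary using (¬_)
open import Relation.Nullary.Decidable using (⌊_⌋)
open import Relation.Binary.PropositionalEquality using (_≡_)

-- Sum of the binary digits of n, computed with fuel (fuel = n suffices).
digitSumFuel : ℕ → ℕ → ℕ
digitSumFuel zero    n = 0
digitSumFuel (suc f) n = n % 2 + digitSumFuel f (n / 2)

binaryDigitSum : ℕ → ℕ
binaryDigitSum n = digitSumFuel n n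

t : ℕ → ℕ
t n = binaryDigitSum n % 2

-- Infinite words over {0,1} are represented as functions ℕ → ℕ (values 0/1).
Word : Set
Word = ℕ → ℕ

xWord : ℕ → Word
xWord N m = if ⌊ m ≤? N ⌋ then t (N ∸ m) else t (m ∸ suc N)

-- Membership in the orbit closure Ω(𝕋) in the product topology:
-- every finite prefix of w occurs as a prefix of some shift Tⁿ(𝕋).
InOrbitClosure : Word → Set
InOrbitClosure w = (k : ℕ) → Σ ℕ λ n → (j : ℕ) → j < k → w j ≡ t (n + j)

-- Subsets of ℕ = positive integers, as predicates on ℕ (0 is excluded explicitly).
Subset : Set₁
Subset = ℕ → Set

restrict : Word → ℕ → Subset
restrict w a m = (1 ≤ m) × (w m ≡ a)

shiftSet : Subset → ℕ → Subset
shiftSet A n m = (1 ≤ m) × A (m + n)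

-- Finite nonempty sets of indices: nonempty duplicate-free lists.
NonEmpty : List ℕ → Set
NonEmpty []      = Data.Empty.⊥ where import Data.Empty
NonEmpty (_ ∷ _) = Data.Unit.⊤ where import Data.Unit

-- IP-set: a sequence ⟨y_t⟩ of positive integers (indexed from 0 here)
-- all of whose finite nonempty sums lie in A.
IPSet : Subset → Set
IPSet A = Σ (ℕ → ℕ) λ y →
  ((i : ℕ) → 1 ≤ y i) ×
  ((F : List ℕ) → NonEmpty F → Unique F → A (sum (map y F)))

ExactlyOne : Set → Set → Set
ExactlyOne P Q = (P × ¬ Q) ⊎ (¬ P × Q)

-- Write s(n) for the binary digit sum, so t n = s(n) mod 2.  Two facts about s carry the proof:
-- s(r + q·2^L) = s(q) + s(r) for r < 2^L, and s(a) + s(b) = L whenever a + b + 1 = 2^L.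
-- With P = 2^L and L odd they give t(2P + a) = t(P − 1 − a) for a < P and t(3P + r) = t r, so
-- t_N … t_0 𝕋 is read off 𝕋 from position 3P − N − 1 on.
-- Every finite sum of y_j = 3·4^j·2^B is V·2^B with s(V) even and s(V − 1) odd; near such sums
-- the letters of x are determined, which makes A_i − n an IP-set for n ≤ N (choosing B) and
-- A_{t k} − (N + 1 + k) an IP-set.  Conversely, by pigeonhole any sequence y has blocks of
-- consecutive terms with sums s₁ = q₁·2^k and s₂ = q₂·2^(k + s₁); one of s₁, s₂, s₁ + s₂ is a
-- finite sum s with t(k + s) = t k, so A_i − (N + 1 + k) is not an IP-set for i ≠ t k.
module Submission where

open import Defs
open import Data.Bool using (Bool; true; false; _∨_; T)
open import Data.Empty using (⊥-elim)
open import Data.Fin using (Fin; toℕ; fromℕ<)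
open import Data.Fin.Properties using (pigeonhole; toℕ-fromℕ<)
open import Data.List using (List; []; _∷_; map; _++_)
open import Data.List.Properties using (map-++)
open import Data.List.Relation.Binary.Disjoint.Propositional using (Disjoint)
open import Data.List.Relation.Unary.All as All using (All; []; _∷_)
open import Data.List.Relation.Unary.AllPairs using ([]; _∷_)
open import Data.List.Relation.Unary.Unique.Propositional using (Unique)
open import Data.List.Relation.Unary.Unique.Propositional.Properties using (++⁺)
open import Data.Nat
  using (ℕ; zero; suc; _+_; _*_; _^_; _≤_; _<_; _≤?_; _≡ᵇ_; NonZero; z≤n; s≤s)
open import Data.Nat.DivMod
open import Data.Nat.Divisibility using (_∣_; divides; ∣m+n∣m⇒∣n)
open import Data.Nat.ListAction using (sum)
open import Data.Nat.ListAction.Properties using (sum-++)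
open import Data.Nat.Properties
open import Data.Nat.Tactic.RingSolver using (solve-∀)
open import Data.Product using (_,_; _×_; ∃-syntax; proj₁; proj₂)
open import Data.Sum using (_⊎_; inj₁; inj₂)
open import Data.Unit using (tt)
open import Function using (_∘_)
open import Relation.Binary.PropositionalEquality
open import Relation.Nullary using (¬_; yes; no)

-- Binary digit sums

bds : ℕ → ℕ
bds = binaryDigitSum

digitSumFuel-zero : ∀ f → digitSumFuel f 0 ≡ 0
digitSumFuel-zero zero    = refl
digitSumFuel-zero (suc f) = digitSumFuel-zero f

half≤ : ∀ n f → n ≤ suc f → n / 2 ≤ f
half≤ zero    f _   = z≤n
half≤ (suc n) f n≤ = ≤-pred (≤-trans (m/n<m (suc n) 2 (s≤s (s≤s z≤n))) n≤)

digitSumFuel-irrelevant : ∀ f g n → n ≤ f → n ≤ g → digitSumFuel f n ≡ digitSumFuel g n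
digitSumFuel-irrelevant zero    g       _ z≤n _   = sym (digitSumFuel-zero g)
digitSumFuel-irrelevant (suc f) zero    _ _   z≤n = digitSumFuel-zero (suc f)
digitSumFuel-irrelevant (suc f) (suc g) n n≤f n≤g =
  cong (n % 2 +_) (digitSumFuel-irrelevant f g (n / 2) (half≤ n f n≤f) (half≤ n g n≤g))

bds-step : ∀ n → bds n ≡ n % 2 + bds (n / 2)
bds-step zero    = refl
bds-step (suc n) = cong (suc n % 2 +_)
  (digitSumFuel-irrelevant n (suc n / 2) (suc n / 2) (half≤ (suc n) n ≤-refl) ≤-refl)

bds-bit : ∀ b m → b < 2 → bds (b + m * 2) ≡ b + bds m
bds-bit b m b<2 = begin
  bds (b + m * 2)                         ≡⟨ bds-step (b + m * 2) ⟩
  (b + m * 2) % 2 + bds ((b + m * 2) / 2) ≡⟨ cong₂ (λ r q → r + bds q) remainder quotient ⟩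
  b + bds m                               ∎
  where
  open ≡-Reasoning
  remainder : (b + m * 2) % 2 ≡ b
  remainder = trans ([m+kn]%n≡m%n b m 2) (m<n⇒m%n≡m b<2)
  no-carry : b % 2 + (m * 2) % 2 < 2
  no-carry = subst (λ r → b % 2 + r < 2) (sym (m*n%n≡0 m 2))
                   (subst (_< 2) (sym (+-identityʳ (b % 2))) (m%n<n b 2))
  quotient : (b + m * 2) / 2 ≡ m
  quotient = begin
    (b + m * 2) / 2   ≡⟨ +-distrib-/ b (m * 2) no-carry ⟩
    b / 2 + m * 2 / 2 ≡⟨ cong₂ _+_ (m<n⇒m/n≡0 b<2) (m*n/n≡m m 2) ⟩
    m                 ∎

bds-bit0 : ∀ m → bds (m * 2) ≡ bds m
bds-bit0 m = bds-bit 0 m (s≤s z≤n)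

bds-bit1 : ∀ m → bds (1 + m * 2) ≡ 1 + bds m
bds-bit1 m = bds-bit 1 m (s≤s (s≤s z≤n))

data LastBit : ℕ → Set where
  bit0 : ∀ m → LastBit (m * 2)
  bit1 : ∀ m → LastBit (1 + m * 2)

lastBit : ∀ n → LastBit n
lastBit zero = bit0 0
lastBit (suc n) with lastBit n
... | bit0 m = bit1 m
... | bit1 m = bit0 (suc m)

bds-concat : ∀ L q r → r < 2 ^ L → bds (r + q * 2 ^ L) ≡ bds q + bds r
bds-concat zero    q (suc r) (s≤s ())
bds-concat zero    q zero    _ = trans (cong bds (*-identityʳ q)) (sym (+-identityʳ (bds q)))
bds-concat (suc L) q r r<2P = begin
  bds (r + q * 2 ^ suc L)               ≡⟨ cong bds split-last-bit ⟩
  bds (r % 2 + (r / 2 + q * 2 ^ L) * 2) ≡⟨ bds-bit (r % 2) (r / 2 + q * 2 ^ L) (m%n<n r 2) ⟩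
  r % 2 + bds (r / 2 + q * 2 ^ L)       ≡⟨ cong (r % 2 +_) (bds-concat L q (r / 2) r/2<P) ⟩
  r % 2 + (bds q + bds (r / 2))         ≡⟨ regroup (r % 2) (bds q) (bds (r / 2)) ⟩
  bds q + (r % 2 + bds (r / 2))         ≡⟨ cong (bds q +_) (bds-step r) ⟨
  bds q + bds r                         ∎
  where
  open ≡-Reasoning
  regroup : ∀ x y z → x + (y + z) ≡ y + (x + z)
  regroup = solve-∀
  r/2<P : r / 2 < 2 ^ L
  r/2<P = m<n*o⇒m/o<n (subst (r <_) (*-comm 2 (2 ^ L)) r<2P)
  split-last-bit : r + q * 2 ^ suc L ≡ r % 2 + (r / 2 + q * 2 ^ L) * 2
  split-last-bit = begin
    r + q * (2 * 2 ^ L)                 ≡⟨ cong (_+ q * (2 * 2 ^ L)) (m≡m%n+[m/n]*n r 2) ⟩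
    r % 2 + r / 2 * 2 + q * (2 * 2 ^ L) ≡⟨ shift (r % 2) (r / 2) q (2 ^ L) ⟩
    r % 2 + (r / 2 + q * 2 ^ L) * 2     ∎
    where
    shift : ∀ b m q P → b + m * 2 + q * (2 * P) ≡ b + (m + q * P) * 2
    shift = solve-∀

odd≢even : ∀ m n → 1 + m * 2 ≢ n * 2
odd≢even m n odd≡even = 1+n≢0 (begin
  1               ≡⟨ [m+kn]%n≡m%n 1 m 2 ⟨
  (1 + m * 2) % 2 ≡⟨ cong (_% 2) odd≡even ⟩
  (n * 2) % 2     ≡⟨ m*n%n≡0 n 2 ⟩
  0               ∎)
  where open ≡-Reasoning

bds-complement : ∀ L a b → suc (a + b) ≡ 2 ^ L → bds a + bds b ≡ L
bds-complement zero    zero    zero    refl = refl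
bds-complement zero    zero    (suc b) ()
bds-complement zero    (suc a) b       ()
bds-complement (suc L) a       b       a+b+1≡2P =
  carry-free (lastBit a) (lastBit b) (trans a+b+1≡2P (*-comm 2 (2 ^ L)))
  where
  open ≡-Reasoning
  halves : ∀ a b → suc (a + b) * 2 ≡ 2 ^ L * 2 → bds a + bds b ≡ L
  halves a b e = bds-complement L a b (*-cancelʳ-≡ _ (2 ^ L) 2 e)
  carry-free : ∀ {a b} → LastBit a → LastBit b → suc (a + b) ≡ 2 ^ L * 2 → bds a + bds b ≡ suc L
  carry-free (bit0 a) (bit0 b) e = ⊥-elim (odd≢even (a + b) (2 ^ L) (trans (regroup a b) e))
    where regroup : ∀ a b → 1 + (a + b) * 2 ≡ suc (a * 2 + b * 2)
          regroup = solve-∀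
  carry-free (bit0 a) (bit1 b) e = begin
    bds (a * 2) + bds (1 + b * 2) ≡⟨ cong₂ _+_ (bds-bit0 a) (bds-bit1 b) ⟩
    bds a + (1 + bds b)           ≡⟨ +-suc (bds a) (bds b) ⟩
    suc (bds a + bds b)           ≡⟨ cong suc (halves a b (trans (regroup a b) e)) ⟩
    suc L                         ∎
    where regroup : ∀ a b → suc (a + b) * 2 ≡ suc (a * 2 + (1 + b * 2))
          regroup = solve-∀
  carry-free (bit1 a) (bit0 b) e = begin
    bds (1 + a * 2) + bds (b * 2) ≡⟨ cong₂ _+_ (bds-bit1 a) (bds-bit0 b) ⟩
    suc (bds a + bds b)           ≡⟨ cong suc (halves a b (trans (regroup a b) e)) ⟩
    suc L                         ∎
    where regroup : ∀ a b → suc (a + b) * 2 ≡ suc ((1 + a * 2) + b * 2)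
          regroup = solve-∀
  carry-free (bit1 a) (bit1 b) e = ⊥-elim (odd≢even (suc (a + b)) (2 ^ L) (trans (regroup a b) e))
    where regroup : ∀ a b → 1 + suc (a + b) * 2 ≡ suc ((1 + a * 2) + (1 + b * 2))
          regroup = solve-∀

n<2^n : ∀ n → n < 2 ^ n
n<2^n zero    = s≤s z≤n
n<2^n (suc n) = subst (suc n <_) (cong (2 ^ n +_) (sym (+-identityʳ (2 ^ n))))
                      (+-mono-≤ (m^n>0 2 n) (n<2^n n))

m+n≡c*2⇒m%2≡n%2 : ∀ m n c → m + n ≡ c * 2 → m % 2 ≡ n % 2
m+n≡c*2⇒m%2≡n%2 m n c m+n≡c*2 = begin
  m % 2           ≡⟨ [m+kn]%n≡m%n m n 2 ⟨
  (m + n * 2) % 2 ≡⟨ cong (_% 2) (regroup m n) ⟩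
  (m + n + n) % 2 ≡⟨ cong (λ x → (x + n) % 2) m+n≡c*2 ⟩
  (c * 2 + n) % 2 ≡⟨ cong (_% 2) (+-comm (c * 2) n) ⟩
  (n + c * 2) % 2 ≡⟨ [m+kn]%n≡m%n n c 2 ⟩
  n % 2           ∎
  where
  open ≡-Reasoning
  regroup : ∀ m n → m + n * 2 ≡ m + n + n
  regroup = solve-∀

flip-twice : ∀ {b} → b ≤ 1 → (1 + (1 + b) % 2) % 2 ≡ b
flip-twice z≤n       = refl
flip-twice (s≤s z≤n) = refl

t≤1 : ∀ n → t n ≤ 1
t≤1 n = ≤-pred (m%n<n (bds n) 2)

t-bit : ∀ n → t n ≡ 0 ⊎ t n ≡ 1
t-bit n with t n | t≤1 n
... | 0 | _         = inj₁ refl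
... | 1 | _         = inj₂ refl
... | suc (suc _) | s≤s ()

t-concat : ∀ L q r → r < 2 ^ L → t (r + q * 2 ^ L) ≡ (t q + t r) % 2
t-concat L q r r<P = begin
  bds (r + q * 2 ^ L) % 2 ≡⟨ cong (_% 2) (bds-concat L q r r<P) ⟩
  (bds q + bds r) % 2     ≡⟨ %-distribˡ-+ (bds q) (bds r) 2 ⟩
  (t q + t r) % 2         ∎
  where open ≡-Reasoning

t-concat-0 : ∀ L q r → t q ≡ 0 → r < 2 ^ L → t (r + q * 2 ^ L) ≡ t r
t-concat-0 L q r tq≡0 r<P = begin
  t (r + q * 2 ^ L) ≡⟨ t-concat L q r r<P ⟩
  (t q + t r) % 2   ≡⟨ cong (λ b → (b + t r) % 2) tq≡0 ⟩
  t r % 2           ≡⟨ m%n%n≡m%n (bds r) 2 ⟩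
  t r               ∎
  where open ≡-Reasoning

t-mirror : ∀ K a i → suc (a + i) ≡ 2 ^ suc (K * 2) → t (a + 2 * 2 ^ suc (K * 2)) ≡ t i
t-mirror K a i a+i+1≡P = begin
  bds (a + 2 * 2 ^ L) % 2 ≡⟨ cong (_% 2) (bds-concat L 2 a a<P) ⟩
  (1 + bds a) % 2         ≡⟨ m+n≡c*2⇒m%2≡n%2 (1 + bds a) (bds i) (suc K)
                               (cong suc (bds-complement L a i a+i+1≡P)) ⟩
  bds i % 2               ∎
  where
  open ≡-Reasoning
  L : ℕ
  L = suc (K * 2)
  a<P : a < 2 ^ L
  a<P = ≤-trans (s≤s (m≤m+n a i)) (≤-reflexive a+i+1≡P)

-- The word x = t_N … t_0 𝕋

xWord-head : ∀ j i → xWord (j + i) j ≡ t i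
xWord-head j i with j ≤? j + i
... | yes _ = cong t (m+n∸m≡n j i)
... | no j≰ = ⊥-elim (j≰ (m≤m+n j i))

xWord-tail : ∀ N r → xWord N (suc N + r) ≡ t r
xWord-tail N r with suc N + r ≤? N
... | yes N<N = ⊥-elim (<-irrefl refl (≤-trans (m≤m+n (suc N) r) N<N))
... | no _    = cong t (m+n∸m≡n (suc N) r)

xWord-tail-shift : ∀ N k m → xWord N (m + (suc N + k)) ≡ t (k + m)
xWord-tail-shift N k m = trans (cong (xWord N) (regroup m N k)) (xWord-tail N (k + m))
  where
  regroup : ∀ m N k → m + (suc N + k) ≡ suc N + (k + m)
  regroup = solve-∀

xWord-occurs-in-t : ∀ K N w j → suc N + w ≡ 2 ^ suc (K * 2) → j < suc N + 2 ^ suc (K * 2) →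
                    xWord N j ≡ t (w + 2 * 2 ^ suc (K * 2) + j)
xWord-occurs-in-t K N w j N+w+1≡P j<N+1+P with ≤-<-connex j N
... | inj₁ j≤N with i , refl ← m≤n⇒∃[o]m+o≡n j≤N = begin
  xWord (j + i) j   ≡⟨ xWord-head j i ⟩
  t i               ≡⟨ t-mirror K (w + j) i (trans (regroup₁ w j i) N+w+1≡P) ⟨
  t (w + j + 2 * P) ≡⟨ cong t (regroup₂ w j P) ⟩
  t (w + 2 * P + j) ∎
  where
  open ≡-Reasoning
  P : ℕ
  P = 2 ^ suc (K * 2)
  regroup₁ : ∀ w j i → suc (w + j + i) ≡ suc (j + i) + w
  regroup₁ = solve-∀
  regroup₂ : ∀ w j P → w + j + 2 * P ≡ w + 2 * P + j
  regroup₂ = solve-∀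
... | inj₂ N<j with r , refl ← m≤n⇒∃[o]m+o≡n N<j = begin
  xWord N (suc N + r)                   ≡⟨ xWord-tail N r ⟩
  t r                                   ≡⟨ t-concat-0 (suc (K * 2)) 3 r refl r<P ⟨
  t (r + 3 * P)                         ≡⟨ cong (λ P → t (r + 3 * P)) N+w+1≡P ⟨
  t (r + 3 * (suc N + w))               ≡⟨ cong t (regroup N w r) ⟩
  t (w + 2 * (suc N + w) + (suc N + r)) ≡⟨ cong (λ P → t (w + 2 * P + (suc N + r))) N+w+1≡P ⟩
  t (w + 2 * P + (suc N + r))           ∎
  where
  open ≡-Reasoning
  P : ℕ
  P = 2 ^ suc (K * 2)
  r<P : r < P
  r<P = +-cancelˡ-< (suc N) r P j<N+1+P
  regroup : ∀ N w r → r + 3 * (suc N + w) ≡ w + 2 * (suc N + w) + (suc N + r)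
  regroup = solve-∀

xWord-inOrbitClosure : ∀ N → InOrbitClosure (xWord N)
xWord-inOrbitClosure N k =
  let w , N+w+1≡P = m≤n⇒∃[o]m+o≡n N<P in
  w + 2 * P , λ j j<k →
    xWord-occurs-in-t K N w j N+w+1≡P (<-≤-trans (<-trans j<k k<P) (m≤n+m P (suc N)))
  where
  K : ℕ
  K = N + k
  P : ℕ
  P = 2 ^ suc (K * 2)
  K<P : K < P
  K<P = <-≤-trans (n<2^n K) (^-monoʳ-≤ 2 (≤-trans (m≤m*n K 2) (n≤1+n (K * 2))))
  N<P : N < P
  N<P = ≤-<-trans (m≤m+n N k) K<P
  k<P : k < P
  k<P = ≤-<-trans (m≤n+m k N) K<P

-- Finite sums of 3·4^j

threeFourPow : ℕ → ℕ
threeFourPow j = 3 * 4 ^ j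

threeFourPow-pos : ∀ j → 1 ≤ threeFourPow j
threeFourPow-pos j = ≤-trans (m^n>0 4 j) (m≤m+n (4 ^ j) _)

digit : Bool → ℕ
digit false = 0
digit true  = 3

base4 : (ℕ → Bool) → ℕ → ℕ
base4 e zero    = 0
base4 e (suc M) = digit (e 0) + base4 (e ∘ suc) M * 4

digit<2^2 : ∀ b → digit b < 2 ^ 2
digit<2^2 false = s≤s z≤n
digit<2^2 true  = s≤s (s≤s (s≤s (s≤s z≤n)))

t-digit : ∀ b → t (digit b) ≡ 0
t-digit false = refl
t-digit true  = refl

t-base4 : ∀ e M → t (base4 e M) ≡ 0
t-base4 e zero    = refl
t-base4 e (suc M) =
  trans (t-concat-0 2 (base4 (e ∘ suc) M) (digit (e 0)) (t-base4 (e ∘ suc) M) (digit<2^2 (e 0)))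
        (t-digit (e 0))

t-base4-pred : ∀ e M {V} → base4 e M ≡ suc V → t V ≡ 1
t-base4-pred e zero    ()
t-base4-pred e (suc M) {V} eq with e 0
... | true = begin
  t V           ≡⟨ cong t (suc-injective eq) ⟨
  t (2 + Q * 4) ≡⟨ t-concat 2 Q 2 (s≤s (s≤s (s≤s z≤n))) ⟩
  (t Q + 1) % 2 ≡⟨ cong (λ b → (b + 1) % 2) (t-base4 (e ∘ suc) M) ⟩
  1             ∎
  where
  open ≡-Reasoning
  Q : ℕ
  Q = base4 (e ∘ suc) M
... | false with base4 (e ∘ suc) M in Q≡1+W
...   | zero  = ⊥-elim (0≢1+n eq)
...   | suc W = begin
  t V           ≡⟨ cong t (suc-injective eq) ⟨
  t (3 + W * 4) ≡⟨ t-concat 2 W 3 (s≤s (s≤s (s≤s (s≤s z≤n)))) ⟩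
  (t W + 0) % 2 ≡⟨ cong (λ b → (b + 0) % 2) (t-base4-pred (e ∘ suc) M Q≡1+W) ⟩
  1             ∎
  where open ≡-Reasoning

base4-false : ∀ M → base4 (λ _ → false) M ≡ 0
base4-false zero    = refl
base4-false (suc M) = cong (_* 4) (base4-false M)

base4-insert : ∀ e i M → e i ≡ false → i < M →
               base4 (λ j → (j ≡ᵇ i) ∨ e j) M ≡ threeFourPow i + base4 e M
base4-insert e zero    (suc M) e0≡false _ rewrite e0≡false = refl
base4-insert e (suc i) (suc M) ei≡false (s≤s i<M) = begin
  digit (e 0) + base4 (λ j → (j ≡ᵇ i) ∨ e (suc j)) M * 4
    ≡⟨ cong (λ Q → digit (e 0) + Q * 4) (base4-insert (e ∘ suc) i M ei≡false i<M) ⟩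
  digit (e 0) + (threeFourPow i + base4 (e ∘ suc) M) * 4
    ≡⟨ regroup (digit (e 0)) (4 ^ i) (base4 (e ∘ suc) M) ⟩
  threeFourPow (suc i) + base4 e (suc M)
    ∎
  where
  open ≡-Reasoning
  regroup : ∀ d x Q → d + (3 * x + Q) * 4 ≡ 3 * (4 * x) + (d + Q * 4)
  regroup = solve-∀

indicator : List ℕ → ℕ → Bool
indicator []      _ = false
indicator (i ∷ F) j = (j ≡ᵇ i) ∨ indicator F j

indicator-∉ : ∀ {i} F → All (i ≢_) F → indicator F i ≡ false
indicator-∉     []      []          = refl
indicator-∉ {i} (z ∷ F) (i≢z ∷ i∉F) with i ≡ᵇ z in i≡ᵇz
... | true  = ⊥-elim (i≢z (≡ᵇ⇒≡ i z (subst T (sym i≡ᵇz) tt)))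
... | false = indicator-∉ F i∉F

sum-threeFourPow≡base4 : ∀ F M → Unique F → All (_< M) F →
                         sum (map threeFourPow F) ≡ base4 (indicator F) M
sum-threeFourPow≡base4 []      M _            _           = sym (base4-false M)
sum-threeFourPow≡base4 (i ∷ F) M (i∉F ∷ uniq) (i<M ∷ F<M) =
  trans (cong (threeFourPow i +_) (sum-threeFourPow≡base4 F M uniq F<M))
        (sym (base4-insert (indicator F) i M (indicator-∉ F i∉F) i<M))

<sum-map-suc : ∀ F → All (_< sum (map suc F)) F
<sum-map-suc []      = []
<sum-map-suc (i ∷ F) = s≤s (m≤m+n i _) ∷ All.map (λ v< → <-≤-trans v< (m≤n+m _ (suc i))) (<sum-map-suc F)

sum-threeFourPow : ∀ F → NonEmpty F → Unique F →
                   ∃[ V ] sum (map threeFourPow F) ≡ suc V × t (suc V) ≡ 0 × t V ≡ 1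
sum-threeFourPow F@(i ∷ _) _ uniq =
  let V , 1+V≡S = m≤n⇒∃[o]m+o≡n 1≤S in
  V , sym 1+V≡S ,
  trans (cong t (trans 1+V≡S S≡base4)) (t-base4 (indicator F) M) ,
  t-base4-pred (indicator F) M (trans (sym S≡base4) (sym 1+V≡S))
  where
  M : ℕ
  M = sum (map suc F)
  S≡base4 : sum (map threeFourPow F) ≡ base4 (indicator F) M
  S≡base4 = sum-threeFourPow≡base4 F M uniq (<sum-map-suc F)
  1≤S : 1 ≤ sum (map threeFourPow F)
  1≤S = ≤-trans (threeFourPow-pos i) (m≤m+n _ _)

-- IP-sets

sum-map-*ʳ : ∀ (f : ℕ → ℕ) c F → sum (map (λ j → f j * c) F) ≡ sum (map f F) * c
sum-map-*ʳ f c []      = refl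
sum-map-*ʳ f c (i ∷ F) = trans (cong (f i * c +_) (sum-map-*ʳ f c F)) (sym (*-distribʳ-+ c (f i) _))

IPSet-scaled : ∀ (A : Subset) B → (∀ V → t (suc V) ≡ 0 → t V ≡ 1 → A (suc V * 2 ^ B)) → IPSet A
IPSet-scaled A B member = (λ j → threeFourPow j * 2 ^ B) , positive , finite-sums
  where
  positive : ∀ j → 1 ≤ threeFourPow j * 2 ^ B
  positive j = *-mono-≤ (threeFourPow-pos j) (m^n>0 2 B)
  finite-sums : ∀ F → NonEmpty F → Unique F → A (sum (map (λ j → threeFourPow j * 2 ^ B) F))
  finite-sums F nonempty uniq =
    let V , S≡1+V , evil , odious = sum-threeFourPow F nonempty uniq in
    subst A (sym (trans (sum-map-*ʳ threeFourPow (2 ^ B) F) (cong (_* 2 ^ B) S≡1+V)))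
            (member V evil odious)

shiftSet-restrict⁺ : ∀ w i n {m} → 1 ≤ m → w (m + n) ≡ i → shiftSet (restrict w i) n m
shiftSet-restrict⁺ w i n {m} 1≤m wm+n≡i = 1≤m , ≤-trans 1≤m (m≤m+n m n) , wm+n≡i

1≤[1+m]*2^n : ∀ m n → 1 ≤ suc m * 2 ^ n
1≤[1+m]*2^n m n = *-mono-≤ (s≤s (z≤n {m})) (m^n>0 2 n)

xWord-IPSet-head : ∀ {N n i} → n ≤ N → i ≤ 1 → IPSet (shiftSet (restrict (xWord N) i) n)
xWord-IPSet-head {N} {n} {i} n≤N i≤1 = IPSet-scaled (shiftSet (restrict (xWord N) i) n) B member
  where
  open ≡-Reasoning
  d : ℕ
  d = proj₁ (m≤n⇒∃[o]m+o≡n n≤N)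
  n+d≡N : n + d ≡ N
  n+d≡N = proj₂ (m≤n⇒∃[o]m+o≡n n≤N)
  -- The complement e = 2^B − 1 − d then has digit sum B − s(d) = 1 + i + 2N.
  B : ℕ
  B = bds d + (suc i + N * 2)
  P : ℕ
  P = 2 ^ B
  d<P : d < P
  d<P = ≤-<-trans (≤-trans (m≤n+m d n) (≤-reflexive n+d≡N)) (<-≤-trans (n<2^n N) (^-monoʳ-≤ 2 N≤B))
    where
    N≤B : N ≤ B
    N≤B = ≤-trans (m≤m*n N 2) (≤-trans (m≤n+m (N * 2) (suc i)) (m≤n+m _ (bds d)))
  e : ℕ
  e = proj₁ (m≤n⇒∃[o]m+o≡n d<P)
  d+e+1≡P : suc (d + e) ≡ P
  d+e+1≡P = proj₂ (m≤n⇒∃[o]m+o≡n d<P)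
  e<P : e < P
  e<P = ≤-trans (s≤s (m≤n+m e d)) (≤-reflexive d+e+1≡P)
  te≡ : t e ≡ suc i % 2
  te≡ = trans (cong (_% 2) (+-cancelˡ-≡ (bds d) (bds e) _ (bds-complement B d e d+e+1≡P)))
              ([m+kn]%n≡m%n (suc i) N 2)
  position : ∀ V → suc V * P + n ≡ suc N + (e + V * P)
  position V = begin
    suc V * P + n                       ≡⟨ cong (λ P → suc V * P + n) d+e+1≡P ⟨
    suc V * suc (d + e) + n             ≡⟨ regroup V n d e ⟩
    suc (n + d) + (e + V * suc (d + e)) ≡⟨ cong₂ (λ N P → suc N + (e + V * P)) n+d≡N d+e+1≡P ⟩
    suc N + (e + V * P)                 ∎
    where
    regroup : ∀ V n d e → suc V * suc (d + e) + n ≡ suc (n + d) + (e + V * suc (d + e))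
    regroup = solve-∀
  member : ∀ V → t (suc V) ≡ 0 → t V ≡ 1 → shiftSet (restrict (xWord N) i) n (suc V * P)
  member V _ odious = shiftSet-restrict⁺ (xWord N) i n (1≤[1+m]*2^n V B) (begin
    xWord N (suc V * P + n)       ≡⟨ cong (xWord N) (position V) ⟩
    xWord N (suc N + (e + V * P)) ≡⟨ xWord-tail N _ ⟩
    t (e + V * P)                 ≡⟨ t-concat B V e e<P ⟩
    (t V + t e) % 2               ≡⟨ cong₂ (λ a b → (a + b) % 2) odious te≡ ⟩
    (1 + suc i % 2) % 2           ≡⟨ flip-twice i≤1 ⟩
    i                             ∎)

xWord-IPSet-tail : ∀ N k → IPSet (shiftSet (restrict (xWord N) (t k)) (suc N + k))
xWord-IPSet-tail N k = IPSet-scaled (shiftSet (restrict (xWord N) (t k)) (suc N + k)) k member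
  where
  member : ∀ V → t (suc V) ≡ 0 → t V ≡ 1 →
           shiftSet (restrict (xWord N) (t k)) (suc N + k) (suc V * 2 ^ k)
  member V evil _ = shiftSet-restrict⁺ (xWord N) (t k) (suc N + k) (1≤[1+m]*2^n V k) (begin
    xWord N (suc V * 2 ^ k + (suc N + k)) ≡⟨ xWord-tail-shift N k (suc V * 2 ^ k) ⟩
    t (k + suc V * 2 ^ k)                 ≡⟨ t-concat-0 k (suc V) k evil (n<2^n k) ⟩
    t k                                   ∎)
    where open ≡-Reasoning

-- Blocks of consecutive terms with divisible sums

interval : ℕ → ℕ → List ℕ
interval a zero    = []
interval a (suc l) = a ∷ interval (suc a) l

interval-++ : ∀ a p l → interval a (p + l) ≡ interval a p ++ interval (a + p) l
interval-++ a zero    l = cong (λ b → interval b l) (sym (+-identityʳ a))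
interval-++ a (suc p) l = cong (a ∷_) (trans (interval-++ (suc a) p l)
                                             (cong (λ b → interval (suc a) p ++ interval b l) (sym (+-suc a p))))

interval-lower : ∀ a l → All (a ≤_) (interval a l)
interval-lower a zero    = []
interval-lower a (suc l) = ≤-refl ∷ All.map (≤-trans (n≤1+n a)) (interval-lower (suc a) l)

interval-upper : ∀ a l → All (_< a + l) (interval a l)
interval-upper a zero    = []
interval-upper a (suc l) =
  m<m+n a (s≤s z≤n) ∷ All.map (λ {v} v< → subst (v <_) (sym (+-suc a l)) v<) (interval-upper (suc a) l)

interval-unique : ∀ a l → Unique (interval a l)
interval-unique a zero    = []
interval-unique a (suc l) = All.map <⇒≢ (interval-lower (suc a) l) ∷ interval-unique (suc a) l

interval-disjoint : ∀ {a b} l l′ → a + l ≤ b → Disjoint (interval a l) (interval b l′)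
interval-disjoint {a} {b} l l′ a+l≤b (v∈I , v∈J) = <-irrefl refl
  (<-≤-trans (All.lookup (interval-upper a l) v∈I) (≤-trans a+l≤b (All.lookup (interval-lower b l′) v∈J)))

sum-map-++ : ∀ (y : ℕ → ℕ) xs ys → sum (map y (xs ++ ys)) ≡ sum (map y xs) + sum (map y ys)
sum-map-++ y xs ys = trans (cong sum (map-++ y xs ys)) (sum-++ (map y xs) (map y ys))

[m+n]%d≡m%d⇒d∣n : ∀ d .{{_ : NonZero d}} m n → (m + n) % d ≡ m % d → d ∣ n
[m+n]%d≡m%d⇒d∣n d m n residues≡ =
  ∣m+n∣m⇒∣n (divides ((m + n) / d) quotients) (divides (m / d) refl)
  where
  open ≡-Reasoning
  quotients : m / d * d + n ≡ (m + n) / d * d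
  quotients = +-cancelˡ-≡ (m % d) _ _ (begin
    m % d + (m / d * d + n)       ≡⟨ +-assoc (m % d) _ n ⟨
    m % d + m / d * d + n         ≡⟨ cong (_+ n) (m≡m%n+[m/n]*n m d) ⟨
    m + n                         ≡⟨ m≡m%n+[m/n]*n (m + n) d ⟩
    (m + n) % d + (m + n) / d * d ≡⟨ cong (_+ (m + n) / d * d) residues≡ ⟩
    m % d + (m + n) / d * d       ∎)

divisible-block : ∀ D .{{_ : NonZero D}} (y : ℕ → ℕ) a →
                  ∃[ b ] ∃[ l ] a ≤ b × D ∣ sum (map y (interval b (suc l)))
divisible-block D y a =
  let p , q , p<q , residue-p≡q = pigeonhole (n<1+n D) residue
      l , p+1+l≡q = m≤n⇒∃[o]m+o≡n p<q
      p+1+l≡q′ = trans (+-suc (toℕ p) l) p+1+l≡q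
  in a + toℕ p , l , m≤m+n a (toℕ p) ,
     [m+n]%d≡m%d⇒d∣n D (prefix (toℕ p)) (block (toℕ p) (suc l)) (begin
       (prefix (toℕ p) + block (toℕ p) (suc l)) % D ≡⟨ cong (_% D) (prefix-++ (toℕ p) (suc l)) ⟨
       prefix (toℕ p + suc l) % D                   ≡⟨ cong (λ r → prefix r % D) p+1+l≡q′ ⟩
       prefix (toℕ q) % D                           ≡⟨ same-residue p q residue-p≡q ⟨
       prefix (toℕ p) % D                           ∎)
  where
  open ≡-Reasoning
  prefix : ℕ → ℕ
  prefix r = sum (map y (interval a r))
  block : ℕ → ℕ → ℕ
  block p l = sum (map y (interval (a + p) l))
  prefix-++ : ∀ p l → prefix (p + l) ≡ prefix p + block p l
  prefix-++ p l = trans (cong (sum ∘ map y) (interval-++ a p l)) (sum-map-++ y (interval a p) _)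
  residue : Fin (suc D) → Fin D
  residue r = fromℕ< (m%n<n (prefix (toℕ r)) D)
  same-residue : ∀ p q → residue p ≡ residue q → prefix (toℕ p) % D ≡ prefix (toℕ q) % D
  same-residue p q eq = trans (sym (toℕ-fromℕ< (m%n<n (prefix (toℕ p)) D)))
                              (trans (cong toℕ eq) (toℕ-fromℕ< (m%n<n (prefix (toℕ q)) D)))

t-invariant-finite-sum : ∀ k (y : ℕ → ℕ) → ∃[ F ] NonEmpty F × Unique F × t (k + sum (map y F)) ≡ t k
t-invariant-finite-sum k y
  with b₁ , l₁ , _ , divides q₁ s₁≡ ← divisible-block (2 ^ k) {{m^n≢0 2 k}} y 0
  with b₂ , l₂ , b₁+l₁≤b₂ , divides q₂ s₂≡ ←
         divisible-block (2 ^ (k + sum (map y (interval b₁ (suc l₁)))))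
                         {{m^n≢0 2 (k + sum (map y (interval b₁ (suc l₁))))}} y (b₁ + suc l₁)
  with t-bit q₁ | t-bit q₂
... | inj₁ tq₁≡0 | _ = interval b₁ (suc l₁) , tt , interval-unique b₁ (suc l₁) ,
  trans (cong (λ s → t (k + s)) s₁≡) (t-concat-0 k q₁ k tq₁≡0 (n<2^n k))
... | inj₂ _ | inj₁ tq₂≡0 = interval b₂ (suc l₂) , tt , interval-unique b₂ (suc l₂) ,
  trans (cong (λ s → t (k + s)) s₂≡) (t-concat-0 (k + s₁) q₂ k tq₂≡0 k<2^[k+s₁])
  where
  s₁ : ℕ
  s₁ = sum (map y (interval b₁ (suc l₁)))
  k<2^[k+s₁] : k < 2 ^ (k + s₁)
  k<2^[k+s₁] = <-≤-trans (n<2^n k) (^-monoʳ-≤ 2 (m≤m+n k s₁))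
... | inj₂ tq₁≡1 | inj₂ tq₂≡1 = I₁ ++ I₂ , tt ,
  ++⁺ (interval-unique b₁ (suc l₁)) (interval-unique b₂ (suc l₂))
      (interval-disjoint (suc l₁) (suc l₂) b₁+l₁≤b₂) ,
  (begin
    t (k + sum (map y (I₁ ++ I₂))) ≡⟨ cong (λ s → t (k + s)) (sum-map-++ y I₁ I₂) ⟩
    t (k + (s₁ + s₂))              ≡⟨ cong t (+-assoc k s₁ s₂) ⟨
    t (k + s₁ + s₂)                ≡⟨ cong (λ s → t (k + s₁ + s)) s₂≡ ⟩
    t (k + s₁ + q₂ * 2 ^ (k + s₁)) ≡⟨ t-concat (k + s₁) q₂ (k + s₁) (n<2^n (k + s₁)) ⟩
    (t q₂ + t (k + s₁)) % 2        ≡⟨ cong₂ (λ a b → (a + b) % 2) tq₂≡1 tk+s₁ ⟩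
    (1 + (1 + t k) % 2) % 2        ≡⟨ flip-twice (t≤1 k) ⟩
    t k                            ∎)
  where
  open ≡-Reasoning
  I₁ : List ℕ
  I₁ = interval b₁ (suc l₁)
  I₂ : List ℕ
  I₂ = interval b₂ (suc l₂)
  s₁ : ℕ
  s₁ = sum (map y I₁)
  s₂ : ℕ
  s₂ = sum (map y I₂)
  tk+s₁ : t (k + s₁) ≡ (1 + t k) % 2
  tk+s₁ = trans (cong (λ s → t (k + s)) s₁≡)
                (trans (t-concat k q₁ k (n<2^n k)) (cong (λ a → (a + t k) % 2) tq₁≡1))

xWord-not-IPSet-tail : ∀ N k i → i ≢ t k → ¬ IPSet (shiftSet (restrict (xWord N) i) (suc N + k))
xWord-not-IPSet-tail N k i i≢tk (y , _ , finite-sums) =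
  let F , nonempty , uniq , invariant = t-invariant-finite-sum k y
      _ , _ , x≡i = finite-sums F nonempty uniq
  in i≢tk (trans (sym x≡i) (trans (xWord-tail-shift N k (sum (map y F))) invariant))

xWord-tail-exactlyOne : ∀ N k → ExactlyOne (IPSet (shiftSet (restrict (xWord N) 0) (suc N + k)))
                                           (IPSet (shiftSet (restrict (xWord N) 1) (suc N + k)))
xWord-tail-exactlyOne N k with t k | t-bit k | xWord-IPSet-tail N k | xWord-not-IPSet-tail N k
... | _ | inj₁ refl | IP₀ | not-IP = inj₁ (IP₀ , not-IP 1 λ ())
... | _ | inj₂ refl | IP₁ | not-IP = inj₂ (not-IP 0 (λ ()) , IP₁)

corollary13 : (N : ℕ) → 1 ≤ N →
    InOrbitClosure (xWord N) ×
    ((i : ℕ) → i ≤ 1 → (n : ℕ) → n ≤ N →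
      IPSet (shiftSet (restrict (xWord N) i) n)) ×
    ((n : ℕ) → N < n →
      ExactlyOne (IPSet (shiftSet (restrict (xWord N) 0) n))
                 (IPSet (shiftSet (restrict (xWord N) 1) n)))
corollary13 N _ = xWord-inOrbitClosure N , (λ i i≤1 n n≤N → xWord-IPSet-head n≤N i≤1) , tail
  where
  tail : (n : ℕ) → N < n → ExactlyOne (IPSet (shiftSet (restrict (xWord N) 0) n))
                                      (IPSet (shiftSet (restrict (xWord N) 1) n))
  tail n N<n with k , refl ← m≤n⇒∃[o]m+o≡n N<n = xWord-tail-exactlyOne N k
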